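{- Let $G$ be an arbitrary graph with vertices $v_1,\dots,v_n$ and let $f_n$ be its associated polynomial. Then for every nonzero real $x$, $$U_G(x)=(-x)^n\cdot f_n\Bigl(1-\tfrac1x,1-\tfrac1x,\dots,1-\tfrac1x\Bigr).$$
   Context: Clique extension of the first kind: for a graph $G$ with vertex set $\{v_1,\dots,v_n\}$ and positive integers $a_1,\dots,a_n$, glue to each $v_i$ a complete graph $K_{a_i}$ on $a_i$ vertices (pairwise disjoint cliques, $K_{a_i}$ meeting $G$ only in $v_i$); the resulting graph is $G(a_1,\dots,a_n)$. The polynomial $f_n=f_n(a_1,\dots,a_n)$ associated with $G$ is the unique real polynomial in $a_1,\dots,a_n$ of degree at most $1$ in each variable such that for all integers $a_1,\dots,a_n\ge2$, $f_n(a_1,\dots,a_n)$ equals the number of independent sets with $n$ vertices in $G(a_1,\dots,a_n)$. The monovariate signed independence polynomial of a graph $H$ is $U_H(x)=\sum_I(-x)^{|I|}$ over all independent sets $I$ of $H$ (including the empty set).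
   Formalization: The variable x ranges over the nonzero rationals rather than the nonzero reals, and the associated polynomial $f_n$ is taken with rational coefficients. -}

module Defs where

open import Data.Nat as ℕ using (ℕ; zero; suc)
open import Data.Fin as Fin using (Fin; zero; suc; toℕ; _≟_)
open import Data.Bool using (Bool; true; false; not; _∧_; if_then_else_)
open import Data.List using (List; []; _∷_; _++_; map; concatMap; length; filterᵇ; foldr; allFin)
open import Data.Vec using (Vec; []; _∷_)
open import Data.Product using (Σ; _,_)
open import Data.Integer using (+_)
open import Relation.Nullary using (yes; no)
open import Relation.Binary.PropositionalEquality using (_≡_)
open import Data.Rational using (ℚ; 0ℚ; 1ℚ; _+_; _*_; -_; _/_)

-- All sublists of a list. For a duplicate-free enumeration of a finite
-- vertex set these are exactly the vertex subsets (each once).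
sublists : {A : Set} → List A → List (List A)
sublists [] = [] ∷ []
sublists (x ∷ xs) = sublists xs ++ map (x ∷_) (sublists xs)

allB : {A : Set} → (A → Bool) → List A → Bool
allB p [] = true
allB p (x ∷ xs) = p x ∧ allB p xs

isIndependent : {V : Set} → (V → V → Bool) → List V → Bool
isIndependent adj [] = true
isIndependent adj (x ∷ xs) =
  allB (λ y → not (adj x y) ∧ not (adj y x)) xs ∧ isIndependent adj xs

independentSets : {V : Set} → (V → V → Bool) → List V → List (List V)
independentSets adj vs = filterᵇ (isIndependent adj) (sublists vs)

-- Clique extension of the first kind G(a₁,…,aₙ)
-- A graph G on vertices Fin n is given by a Bool adjacency matrix
-- (symmetry and irreflexivity are hypotheses of the theorem).
-- Vertices of G(a): pairs (i , j) with j : Fin (a i); (i , 0) is v_i,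
-- and {(i , j) | j : Fin (a i)} is the clique K_{a i} glued at v_i.

ExtV : (n : ℕ) → (Fin n → ℕ) → Set
ExtV n a = Σ (Fin n) (λ i → Fin (a i))

extEnum : (n : ℕ) (a : Fin n → ℕ) → List (ExtV n a)
extEnum n a = concatMap (λ i → map (i ,_) (allFin (a i))) (allFin n)

isZeroF : {m : ℕ} → Fin m → Bool
isZeroF zero = true
isZeroF (suc _) = false

extAdj : (n : ℕ) (adj : Fin n → Fin n → Bool) (a : Fin n → ℕ) →
         ExtV n a → ExtV n a → Bool
extAdj n adj a (i , j) (k , l) with i ≟ k
... | yes _ = not (toℕ j ℕ.≡ᵇ toℕ l)
... | no _  = isZeroF j ∧ isZeroF l ∧ adj i k

numIndepExt : (n : ℕ) (adj : Fin n → Fin n → Bool) (a : Fin n → ℕ) → ℕ → ℕ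
numIndepExt n adj a k =
  length (filterᵇ (λ I → length I ℕ.≡ᵇ k)
                  (independentSets (extAdj n adj a) (extEnum n a)))

ℕtoℚ : ℕ → ℚ
ℕtoℚ m = (+ m) / 1

powℚ : ℚ → ℕ → ℚ
powℚ x zero = 1ℚ
powℚ x (suc k) = x * powℚ x k

sumℚ : List ℚ → ℚ
sumℚ = foldr _+_ 0ℚ

-- Multilinear polynomials (degree ≤ 1 in each variable) in n variables
-- with rational coefficients: a coefficient for each monomial
-- ∏_{i ∈ S} a_i, S ⊆ {1..n} given as its characteristic vector.

MultiLin : ℕ → Set
MultiLin n = Vec Bool n → ℚ

allSubsets : (n : ℕ) → List (Vec Bool n)
allSubsets zero = [] ∷ []
allSubsets (suc n) = map (false ∷_) (allSubsets n) ++ map (true ∷_) (allSubsets n)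

monomial : {n : ℕ} → Vec Bool n → (Fin n → ℚ) → ℚ
monomial [] a = 1ℚ
monomial (b ∷ S) a = (if b then a zero else 1ℚ) * monomial S (λ i → a (suc i))

evalML : {n : ℕ} → MultiLin n → (Fin n → ℚ) → ℚ
evalML {n} c a = sumℚ (map (λ S → c S * monomial S a) (allSubsets n))

IsAssociatedPoly : (n : ℕ) (adj : Fin n → Fin n → Bool) → MultiLin n → Set
IsAssociatedPoly n adj f =
  (a : Fin n → ℕ) → (∀ i → 2 ℕ.≤ a i) →
  evalML f (λ i → ℕtoℚ (a i)) ≡ ℕtoℚ (numIndepExt n adj a n)

signedIndepPoly : (n : ℕ) (adj : Fin n → Fin n → Bool) → ℚ → ℚ
signedIndepPoly n adj x =
  sumℚ (map (λ I → powℚ (- x) (length I)) (independentSets adj (allFin n)))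

{-# OPTIONS --safe #-}

-- Both sides obey the same recurrence along the first vertex v. An independent n-set of G(a)
-- takes exactly one vertex from every clique: either the root v, which excludes the roots of
-- its neighbours, or one of the a_v − 1 other vertices of K_{a_v}, which constrains nothing.
-- Hence the count is P_G(a) = P_{G−N[v]}(a) + (a_v − 1) P_{G−v}(a), a polynomial that is
-- affine in each variable. Agreeing with f on {2,3}ⁿ, it equals f. At a_i = 1 − 1/x one has
-- (−x)(a_v − 1) = 1, so (−x)ⁿ P_G turns the recurrence into U_G = U_{G−v} − x U_{G−N[v]},
-- the deletion recurrence of the signed independence polynomial.
module Submission where

open import Defs
open import Algebra.Bundles using (CommutativeMonoid)
open import Data.Bool using (Bool; true; false; not; _∧_; if_then_else_)
open import Data.Bool.Properties using (∧-assoc; ∧-identityʳ; ∧-zeroʳ; ∧-commutativeMonoid; if-eta)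
open import Data.Fin as Fin using (Fin; zero; suc; toℕ)
open import Data.Fin.Properties using (toℕ-injective)
open import Data.List
  using (List; []; _∷_; _++_; map; concat; concatMap; length; filterᵇ; allFin; tabulate)
open import Data.List.Properties
  using (map-++; map-∘; map-cong; length-map; map-tabulate; concatMap-map; map-concatMap)
open import Data.List.Relation.Unary.All as All using (All; []; _∷_)
open import Data.List.Relation.Unary.AllPairs using (AllPairs; []; _∷_)
open import Data.List.Relation.Unary.AllPairs.Properties using (map⁺; tabulate⁺)
open import Data.Nat as ℕ using (ℕ; zero; suc; s≤s; z≤n)
import Data.Nat.Coprimality as Coprimality
import Data.Nat.Properties as ℕ
import Data.Integer as ℤ
import Data.Integer.Properties as ℤ
open import Data.Product using (_×_; _,_; proj₁; proj₂)
open import Data.Rational using (ℚ; NonZero; mkℚ; 0ℚ; 1ℚ; _+_; _-_; _*_; -_; 1/_; _/_)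
open import Data.Rational.Properties
  using (_≟_; +-*-commutativeRing; normalize-coprime; /-cong; +-identityˡ; +-identityʳ; +-assoc;
         *-identityˡ; *-zeroˡ; *-zeroʳ; *-assoc; *-distribˡ-+; *-inverseʳ)
open import Data.Sum using (_⊎_; inj₁; inj₂)
open import Data.Vec using (Vec; []; _∷_)
import Data.Vec.Functional as Vector
open import Function using (_∘_; id)
open import Relation.Binary.PropositionalEquality
open import Relation.Nullary using (yes; no; contradiction)
open import Relation.Nullary.Decidable using (dec-false; dec⇒maybe)
open import Tactic.RingSolver using (solve-∀)
open import Tactic.RingSolver.Core.AlmostCommutativeRing
  using (AlmostCommutativeRing; fromCommutativeRing)
open import Algebra.Properties.CommutativeSemigroup
  (CommutativeMonoid.commutativeSemigroup ∧-commutativeMonoid) using (interchange)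
open ≡-Reasoning

private
  variable
    A B : Set

ℚ-ring : AlmostCommutativeRing _ _
ℚ-ring = fromCommutativeRing +-*-commutativeRing (λ x → dec⇒maybe (0ℚ ≟ x))

ℕtoℚ-suc : ∀ m → ℕtoℚ (suc m) ≡ 1ℚ + ℕtoℚ m
ℕtoℚ-suc m = begin
  ℕtoℚ (suc m)                   ≡⟨ /-cong (cong (ℤ._+_ ℤ.1ℤ) (sym (ℤ.*-identityʳ (ℤ.+ m)))) refl ⟩
  (ℤ.1ℤ ℤ.+ ℤ.+ m ℤ.* ℤ.1ℤ) / 1   ≡⟨⟩
  1ℚ + mkℚ (ℤ.+ m) 0 m⊥1          ≡⟨ cong (1ℚ +_) (normalize-coprime m⊥1) ⟨
  1ℚ + ℕtoℚ m                    ∎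
  where m⊥1 = Coprimality.sym (Coprimality.1-coprimeTo m)

𝟙[_] : Bool → ℚ
𝟙[ b ] = if b then 1ℚ else 0ℚ

𝟙-∧ : ∀ b c → 𝟙[ b ∧ c ] ≡ 𝟙[ b ] * 𝟙[ c ]
𝟙-∧ true  c = sym (*-identityˡ 𝟙[ c ])
𝟙-∧ false c = sym (*-zeroˡ 𝟙[ c ])

sumℚ-++ : (xs ys : List ℚ) → sumℚ (xs ++ ys) ≡ sumℚ xs + sumℚ ys
sumℚ-++ []       ys = sym (+-identityˡ (sumℚ ys))
sumℚ-++ (x ∷ xs) ys = trans (cong (x +_) (sumℚ-++ xs ys)) (sym (+-assoc x (sumℚ xs) (sumℚ ys)))

sumℚ-*ˡ : ∀ c (h : A → ℚ) xs → sumℚ (map (λ x → c * h x) xs) ≡ c * sumℚ (map h xs)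
sumℚ-*ˡ c h []       = sym (*-zeroʳ c)
sumℚ-*ˡ c h (x ∷ xs) =
  trans (cong (c * h x +_) (sumℚ-*ˡ c h xs)) (sym (*-distribˡ-+ c (h x) (sumℚ (map h xs))))

sumℚ-filterᵇ : ∀ (h : A → ℚ) p xs →
               sumℚ (map h (filterᵇ p xs)) ≡ sumℚ (map (λ x → 𝟙[ p x ] * h x) xs)
sumℚ-filterᵇ h p [] = refl
sumℚ-filterᵇ h p (x ∷ xs) with p x
... | true  = cong₂ _+_ (sym (*-identityˡ (h x))) (sumℚ-filterᵇ h p xs)
... | false = trans (sumℚ-filterᵇ h p xs)
                    (sym (trans (cong (_+ _) (*-zeroˡ (h x))) (+-identityˡ _)))

ℕtoℚ-length-filterᵇ : ∀ p (xs : List A) →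
                      ℕtoℚ (length (filterᵇ p xs)) ≡ sumℚ (map (λ x → 𝟙[ p x ]) xs)
ℕtoℚ-length-filterᵇ p [] = refl
ℕtoℚ-length-filterᵇ p (x ∷ xs) with p x
... | true  = trans (ℕtoℚ-suc (length (filterᵇ p xs)))
                    (cong (1ℚ +_) (ℕtoℚ-length-filterᵇ p xs))
... | false = trans (ℕtoℚ-length-filterᵇ p xs) (sym (+-identityˡ _))

sumℚ-tabulate-const : ∀ m c → sumℚ (tabulate {n = m} (λ _ → c)) ≡ ℕtoℚ m * c
sumℚ-tabulate-const zero    c = sym (*-zeroˡ c)
sumℚ-tabulate-const (suc m) c = begin
  c + sumℚ (tabulate {n = m} (λ _ → c))  ≡⟨ cong (c +_) (sumℚ-tabulate-const m c) ⟩
  c + ℕtoℚ m * c                         ≡⟨ distrib c (ℕtoℚ m) ⟩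
  (1ℚ + ℕtoℚ m) * c                      ≡⟨ cong (_* c) (ℕtoℚ-suc m) ⟨
  ℕtoℚ (suc m) * c                       ∎
  where
  distrib : ∀ c y → c + y * c ≡ (1ℚ + y) * c
  distrib = solve-∀ ℚ-ring

sumℚ-allFin-isZeroF : ∀ m .{{_ : ℕ.NonZero m}} (F : Bool → ℚ) →
                      sumℚ (map (λ j → F (isZeroF j)) (allFin m)) ≡ F true + (ℕtoℚ m - 1ℚ) * F false
sumℚ-allFin-isZeroF (suc m) F = cong (F true +_) (begin
  sumℚ (map (λ j → F (isZeroF j)) (tabulate {n = m} suc))
    ≡⟨ cong sumℚ (map-tabulate {n = m} suc (λ j → F (isZeroF j))) ⟩
  sumℚ (tabulate {n = m} (λ _ → F false))
    ≡⟨ sumℚ-tabulate-const m (F false) ⟩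
  ℕtoℚ m * F false
    ≡⟨ cong (_* F false) (cancel (ℕtoℚ m)) ⟩
  ((1ℚ + ℕtoℚ m) - 1ℚ) * F false
    ≡⟨ cong (λ q → (q - 1ℚ) * F false) (ℕtoℚ-suc m) ⟨
  (ℕtoℚ (suc m) - 1ℚ) * F false
    ∎)
  where
  cancel : ∀ y → y ≡ (1ℚ + y) - 1ℚ
  cancel = solve-∀ ℚ-ring

allB-∧ : ∀ (p q : A → Bool) xs → allB (λ x → p x ∧ q x) xs ≡ allB p xs ∧ allB q xs
allB-∧ p q []       = refl
allB-∧ p q (x ∷ xs) =
  trans (cong ((p x ∧ q x) ∧_) (allB-∧ p q xs)) (interchange (p x) (q x) (allB p xs) (allB q xs))

allB-true : {p : A → Bool} → (∀ x → p x ≡ true) → ∀ xs → allB p xs ≡ true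
allB-true p≡true []       = refl
allB-true p≡true (x ∷ xs) = cong₂ _∧_ (p≡true x) (allB-true p≡true xs)

allB-map : {p : B → Bool} {q : A → Bool} (h : A → B) → (∀ x → p (h x) ≡ q x) →
           ∀ xs → allB p (map h xs) ≡ allB q xs
allB-map h p∘h≡q []       = refl
allB-map h p∘h≡q (x ∷ xs) = cong₂ _∧_ (p∘h≡q x) (allB-map h p∘h≡q xs)

isIndependent-map : {E : B → B → Bool} {E′ : A → A → Bool} (h : A → B) →
                    (∀ x y → E (h x) (h y) ≡ E′ x y) →
                    ∀ xs → isIndependent E (map h xs) ≡ isIndependent E′ xs
isIndependent-map h E∘h≡E′ []       = refl
isIndependent-map h E∘h≡E′ (x ∷ xs) =
  cong₂ _∧_ (allB-map h (λ y → cong₂ (λ u v → not u ∧ not v) (E∘h≡E′ x y) (E∘h≡E′ y x)) xs)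
            (isIndependent-map h E∘h≡E′ xs)

sublists-map : (h : A → B) (xs : List A) → sublists (map h xs) ≡ map (map h) (sublists xs)
sublists-map h []       = refl
sublists-map h (x ∷ xs) = begin
  sublists (map h xs) ++ map (h x ∷_) (sublists (map h xs))
    ≡⟨ cong (λ L → L ++ map (h x ∷_) L) (sublists-map h xs) ⟩
  map (map h) S ++ map (h x ∷_) (map (map h) S)
    ≡⟨ cong (map (map h) S ++_) (trans (sym (map-∘ S)) (map-∘ S)) ⟩
  map (map h) S ++ map (map h) (map (x ∷_) S)
    ≡⟨ map-++ (map h) S (map (x ∷_) S) ⟨
  map (map h) (S ++ map (x ∷_) S)
    ∎
  where S = sublists xs

module _ {V : Set} (E : V → V → Bool) where

  nonAdjacent : V → V → Bool
  nonAdjacent u v = not (E u v) ∧ not (E v u)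

  indepSum : (V → Bool) → (ℕ → ℚ) → List V → ℚ
  indepSum ok g L = sumℚ (map (λ t → 𝟙[ allB ok t ∧ isIndependent E t ] * g (length t)) (sublists L))

  indepSum-[] : ∀ ok g → indepSum ok g [] ≡ g 0
  indepSum-[] ok g = trans (+-identityʳ _) (*-identityˡ (g 0))

  indepSum-∷ : ∀ ok g v L →
               indepSum ok g (v ∷ L) ≡
               indepSum ok g L + 𝟙[ ok v ] * indepSum (λ u → ok u ∧ nonAdjacent v u) (g ∘ suc) L
  indepSum-∷ ok g v L = begin
    sumℚ (map term (S ++ map (v ∷_) S))
      ≡⟨ cong sumℚ (map-++ term S (map (v ∷_) S)) ⟩
    sumℚ (map term S ++ map term (map (v ∷_) S))
      ≡⟨ sumℚ-++ (map term S) _ ⟩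
    indepSum ok g L + sumℚ (map term (map (v ∷_) S))
      ≡⟨ cong (λ q → indepSum ok g L + sumℚ q) (sym (map-∘ S)) ⟩
    indepSum ok g L + sumℚ (map (term ∘ (v ∷_)) S)
      ≡⟨ cong (λ q → indepSum ok g L + sumℚ q) (map-cong term-∷ S) ⟩
    indepSum ok g L + sumℚ (map (λ t → 𝟙[ ok v ] * term′ t) S)
      ≡⟨ cong (indepSum ok g L +_) (sumℚ-*ˡ 𝟙[ ok v ] term′ S) ⟩
    indepSum ok g L + 𝟙[ ok v ] * indepSum ok′ (g ∘ suc) L
      ∎
    where
    S = sublists L
    ok′ : V → Bool
    ok′ u = ok u ∧ nonAdjacent v u
    term : List V → ℚ
    term t = 𝟙[ allB ok t ∧ isIndependent E t ] * g (length t)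
    term′ : List V → ℚ
    term′ t = 𝟙[ allB ok′ t ∧ isIndependent E t ] * g (suc (length t))
    regroup : ∀ a b c d → (a ∧ b) ∧ (c ∧ d) ≡ a ∧ ((b ∧ c) ∧ d)
    regroup a b c d = trans (∧-assoc a b (c ∧ d)) (cong (a ∧_) (sym (∧-assoc b c d)))
    term-∷ : ∀ t → term (v ∷ t) ≡ 𝟙[ ok v ] * term′ t
    term-∷ t = begin
      𝟙[ (ok v ∧ allB ok t) ∧ (allB (nonAdjacent v) t ∧ isIndependent E t) ] * g (suc (length t))
        ≡⟨ cong (λ b → 𝟙[ b ] * g (suc (length t)))
                (trans (regroup (ok v) _ _ _)
                       (cong (λ b → ok v ∧ (b ∧ isIndependent E t)) (sym (allB-∧ ok (nonAdjacent v) t)))) ⟩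
      𝟙[ ok v ∧ (allB ok′ t ∧ isIndependent E t) ] * g (suc (length t))
        ≡⟨ cong (_* g (suc (length t))) (𝟙-∧ (ok v) _) ⟩
      (𝟙[ ok v ] * 𝟙[ allB ok′ t ∧ isIndependent E t ]) * g (suc (length t))
        ≡⟨ *-assoc 𝟙[ ok v ] _ _ ⟩
      𝟙[ ok v ] * term′ t
        ∎

  indepSum-*ˡ : ∀ ok c g L → indepSum ok (λ k → c * g k) L ≡ c * indepSum ok g L
  indepSum-*ˡ ok c g L =
    trans (cong sumℚ (map-cong (λ t → swap 𝟙[ allB ok t ∧ isIndependent E t ] c (g (length t))) S))
          (sumℚ-*ˡ c (λ t → 𝟙[ allB ok t ∧ isIndependent E t ] * g (length t)) S)
    where
    S = sublists L
    swap : ∀ p c q → p * (c * q) ≡ c * (p * q)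
    swap = solve-∀ ℚ-ring

  indepSum-unrestricted : ∀ {ok} → (∀ v → ok v ≡ true) → ∀ g L →
                          indepSum ok g L ≡ sumℚ (map (λ t → g (length t)) (independentSets E L))
  indepSum-unrestricted ok≡true g L =
    trans (cong sumℚ (map-cong (λ t → cong (λ b → 𝟙[ b ∧ isIndependent E t ] * g (length t))
                                           (allB-true ok≡true t))
                               (sublists L)))
          (sym (sumℚ-filterᵇ (λ t → g (length t)) (isIndependent E) (sublists L)))

  indepSum-++-excluded : ∀ {ok} g B L → All (λ v → ok v ≡ false) B →
                         indepSum ok g (B ++ L) ≡ indepSum ok g L
  indepSum-++-excluded      g []      L []                            = refl
  indepSum-++-excluded {ok} g (v ∷ B) L (ok-v≡false ∷ B-excluded) = begin
    indepSum ok g (v ∷ B ++ L)                 ≡⟨ indepSum-∷ ok g v (B ++ L) ⟩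
    indepSum ok g (B ++ L) + 𝟙[ ok v ] * rest  ≡⟨ cong (λ b → indepSum ok g (B ++ L) + 𝟙[ b ] * rest) ok-v≡false ⟩
    indepSum ok g (B ++ L) + 0ℚ * rest         ≡⟨ cong (indepSum ok g (B ++ L) +_) (*-zeroˡ rest) ⟩
    indepSum ok g (B ++ L) + 0ℚ                ≡⟨ +-identityʳ _ ⟩
    indepSum ok g (B ++ L)                     ≡⟨ indepSum-++-excluded g B L B-excluded ⟩
    indepSum ok g L                            ∎
    where rest = indepSum (λ u → ok u ∧ nonAdjacent v u) (g ∘ suc) (B ++ L)

  -- An independent set meets a clique in at most one vertex.
  indepSum-++-clique : ∀ ok g B L → AllPairs (λ u v → nonAdjacent u v ≡ false) B →
                       indepSum ok g (B ++ L) ≡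
                       indepSum ok g L
                       + sumℚ (map (λ v → 𝟙[ ok v ] * indepSum (λ u → ok u ∧ nonAdjacent v u) (g ∘ suc) L) B)
  indepSum-++-clique ok g []      L []                 = sym (+-identityʳ _)
  indepSum-++-clique ok g (v ∷ B) L (v-adj-B ∷ clique) = begin
    indepSum ok g (v ∷ B ++ L)
      ≡⟨ indepSum-∷ ok g v (B ++ L) ⟩
    indepSum ok g (B ++ L) + 𝟙[ ok v ] * indepSum ok-v (g ∘ suc) (B ++ L)
      ≡⟨ cong₂ (λ p q → p + 𝟙[ ok v ] * q)
               (indepSum-++-clique ok g B L clique)
               (indepSum-++-excluded (g ∘ suc) B L
                 (All.map (λ {u} nonAdj≡false → trans (cong (ok u ∧_) nonAdj≡false) (∧-zeroʳ (ok u)))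
                          v-adj-B)) ⟩
    (indepSum ok g L + rest) + 𝟙[ ok v ] * indepSum ok-v (g ∘ suc) L
      ≡⟨ rotate (indepSum ok g L) rest _ ⟩
    indepSum ok g L + (𝟙[ ok v ] * indepSum ok-v (g ∘ suc) L + rest)
      ∎
    where
    ok-v : V → Bool
    ok-v u = ok u ∧ nonAdjacent v u
    rest = sumℚ (map (λ w → 𝟙[ ok w ] * indepSum (λ u → ok u ∧ nonAdjacent w u) (g ∘ suc) L) B)
    rotate : ∀ p r s → (p + r) + s ≡ p + (s + r)
    rotate = solve-∀ ℚ-ring

indepSum-map : (E : B → B → Bool) (E′ : A → A → Bool) {ok : B → Bool} {ok′ : A → Bool} (h : A → B) →
               (∀ x y → E (h x) (h y) ≡ E′ x y) → (∀ x → ok (h x) ≡ ok′ x) →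
               ∀ g L → indepSum E ok g (map h L) ≡ indepSum E′ ok′ g L
indepSum-map {B = B} E E′ {ok} {ok′} h E∘h≡E′ ok∘h≡ok′ g L = begin
  sumℚ (map term (sublists (map h L)))        ≡⟨ cong (sumℚ ∘ map term) (sublists-map h L) ⟩
  sumℚ (map term (map (map h) (sublists L)))  ≡⟨ cong sumℚ (map-∘ (sublists L)) ⟨
  sumℚ (map (term ∘ map h) (sublists L))      ≡⟨ cong sumℚ (map-cong term-map (sublists L)) ⟩
  indepSum E′ ok′ g L                         ∎
  where
  term : List B → ℚ
  term t = 𝟙[ allB ok t ∧ isIndependent E t ] * g (length t)
  term-map : ∀ t → term (map h t) ≡ 𝟙[ allB ok′ t ∧ isIndependent E′ t ] * g (length t)
  term-map t = cong₂ (λ b k → 𝟙[ b ] * g k)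
                     (cong₂ _∧_ (allB-map h ok∘h≡ok′ t) (isIndependent-map h E∘h≡E′ t))
                     (length-map h t)

deleteVertex₀ : ∀ {n} → (Fin (suc n) → Fin (suc n) → Bool) → Fin n → Fin n → Bool
deleteVertex₀ adj i k = adj (suc i) (suc k)

outsideNeighbourhood₀ : ∀ {n} → (Fin (suc n) → Fin (suc n) → Bool) → (Fin (suc n) → Bool) → Fin n → Bool
outsideNeighbourhood₀ adj ok i = ok (suc i) ∧ nonAdjacent adj zero (suc i)

indepSum-allFin-suc : ∀ {n} adj ok g →
  indepSum adj ok g (allFin (suc n)) ≡
  indepSum (deleteVertex₀ adj) (ok ∘ suc) g (allFin n)
  + 𝟙[ ok zero ] * indepSum (deleteVertex₀ adj) (outsideNeighbourhood₀ adj ok) (g ∘ suc) (allFin n)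
indepSum-allFin-suc {n} adj ok g =
  trans (indepSum-∷ adj ok g zero (tabulate suc))
        (cong₂ (λ p q → p + 𝟙[ ok zero ] * q) (shifted ok g) (shifted _ (g ∘ suc)))
  where
  shifted : ∀ ok′ g′ →
            indepSum adj ok′ g′ (tabulate suc) ≡ indepSum (deleteVertex₀ adj) (ok′ ∘ suc) g′ (allFin n)
  shifted ok′ g′ =
    trans (cong (indepSum adj ok′ g′) (sym (map-tabulate id suc)))
          (indepSum-map adj (deleteVertex₀ adj) suc (λ _ _ → refl) (λ _ → refl) g′ (allFin n))

-- Σ_S ∏_{i ∉ S} (aᵢ − 1) over the independent sets S of ok-vertices, expanded at the first vertex.
cliqueExtensionPoly : (n : ℕ) → (Fin n → Fin n → Bool) → (Fin n → Bool) → (Fin n → ℚ) → ℚ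
cliqueExtensionPoly zero    adj ok a = 1ℚ
cliqueExtensionPoly (suc n) adj ok a =
  𝟙[ ok zero ] * cliqueExtensionPoly n (deleteVertex₀ adj) (outsideNeighbourhood₀ adj ok) (a ∘ suc)
  + (a zero - 1ℚ) * cliqueExtensionPoly n (deleteVertex₀ adj) (ok ∘ suc) (a ∘ suc)

indepSum-signed≡cliqueExtensionPoly : ∀ (x : ℚ) .{{_ : NonZero x}} n adj ok →
  indepSum adj ok (powℚ (- x)) (allFin n) ≡ powℚ (- x) n * cliqueExtensionPoly n adj ok (λ _ → 1ℚ - 1/ x)
indepSum-signed≡cliqueExtensionPoly x zero    adj ok =
  trans (indepSum-[] adj ok (powℚ (- x))) (sym (*-identityˡ 1ℚ))
indepSum-signed≡cliqueExtensionPoly x (suc n) adj ok = begin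
  indepSum adj ok (powℚ (- x)) (allFin (suc n))
    ≡⟨ indepSum-allFin-suc adj ok (powℚ (- x)) ⟩
  indepSum adj′ (ok ∘ suc) (powℚ (- x)) (allFin n)
  + 𝟙[ ok zero ] * indepSum adj′ ok′ (λ k → (- x) * powℚ (- x) k) (allFin n)
    ≡⟨ cong (λ q → indepSum adj′ (ok ∘ suc) (powℚ (- x)) (allFin n) + 𝟙[ ok zero ] * q)
            (indepSum-*ˡ adj′ ok′ (- x) (powℚ (- x)) (allFin n)) ⟩
  indepSum adj′ (ok ∘ suc) (powℚ (- x)) (allFin n)
  + 𝟙[ ok zero ] * ((- x) * indepSum adj′ ok′ (powℚ (- x)) (allFin n))
    ≡⟨ cong₂ (λ p q → p + 𝟙[ ok zero ] * ((- x) * q))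
             (indepSum-signed≡cliqueExtensionPoly x n adj′ (ok ∘ suc))
             (indepSum-signed≡cliqueExtensionPoly x n adj′ ok′) ⟩
  X * P + 𝟙[ ok zero ] * ((- x) * (X * P′))
    ≡⟨ cong (_+ 𝟙[ ok zero ] * ((- x) * (X * P′))) (*-identityˡ (X * P)) ⟨
  1ℚ * (X * P) + 𝟙[ ok zero ] * ((- x) * (X * P′))
    ≡⟨ cong (λ u → u * (X * P) + 𝟙[ ok zero ] * ((- x) * (X * P′)))
            (trans (cancel x (1/ x)) (*-inverseʳ x)) ⟨
  ((- x) * (c - 1ℚ)) * (X * P) + 𝟙[ ok zero ] * ((- x) * (X * P′))
    ≡⟨ expand (- x) X 𝟙[ ok zero ] P′ P c ⟩
  ((- x) * X) * (𝟙[ ok zero ] * P′ + (c - 1ℚ) * P)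
    ∎
  where
  adj′ = deleteVertex₀ adj
  ok′ = outsideNeighbourhood₀ adj ok
  c = 1ℚ - 1/ x
  X = powℚ (- x) n
  P = cliqueExtensionPoly n adj′ (ok ∘ suc) (λ _ → c)
  P′ = cliqueExtensionPoly n adj′ ok′ (λ _ → c)
  cancel : ∀ x y → (- x) * ((1ℚ - y) - 1ℚ) ≡ x * y
  cancel = solve-∀ ℚ-ring
  expand : ∀ y X b P′ P c →
           (y * (c - 1ℚ)) * (X * P) + b * (y * (X * P′)) ≡ (y * X) * (b * P′ + (c - 1ℚ) * P)
  expand = solve-∀ ℚ-ring

-- A non-root vertex of G(a) has neighbours only inside its own clique,
-- so vertices chosen earlier can only exclude roots.
rootOk : ∀ {n} {a : Fin n → ℕ} → (Fin n → Bool) → ExtV n a → Bool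
rootOk ok (i , j) = if isZeroF j then ok i else true

extSum : (n : ℕ) → (Fin n → Fin n → Bool) → (a : Fin n → ℕ) → (Fin n → Bool) → (ℕ → ℚ) → ℚ
extSum n adj a ok g = indepSum (extAdj n adj a) (rootOk ok) g (extEnum n a)

shiftBlock : ∀ {n} {a : Fin (suc n) → ℕ} → ExtV n (a ∘ suc) → ExtV (suc n) a
shiftBlock (i , j) = suc i , j

extEnum-suc : ∀ n (a : Fin (suc n) → ℕ) →
              extEnum (suc n) a ≡ map (zero ,_) (allFin (a zero)) ++ map shiftBlock (extEnum n (a ∘ suc))
extEnum-suc n a = cong (map (zero ,_) (allFin (a zero)) ++_) (begin
  concatMap block (tabulate suc)
    ≡⟨ cong (concatMap block) (map-tabulate id suc) ⟨
  concatMap block (map suc (allFin n))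
    ≡⟨ concatMap-map block suc (allFin n) ⟩
  concatMap (block ∘ suc) (allFin n)
    ≡⟨ cong concat (map-cong (λ i → map-∘ (allFin (a (suc i)))) (allFin n)) ⟩
  concatMap (map shiftBlock ∘ block′) (allFin n)
    ≡⟨ map-concatMap shiftBlock block′ (allFin n) ⟨
  map shiftBlock (extEnum n (a ∘ suc))
    ∎)
  where
  block : (i : Fin (suc n)) → List (ExtV (suc n) a)
  block i = map (i ,_) (allFin (a i))
  block′ : (i : Fin n) → List (ExtV n (a ∘ suc))
  block′ i = map (i ,_) (allFin (a (suc i)))

extAdj-shiftBlock : ∀ n adj (a : Fin (suc n) → ℕ) u v →
  extAdj (suc n) adj a (shiftBlock u) (shiftBlock v) ≡ extAdj n (deleteVertex₀ adj) (a ∘ suc) u v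
extAdj-shiftBlock n adj a (i , j) (k , l) with i Fin.≟ k
... | yes _ = refl
... | no  _ = refl

extAdj-sameBlock : ∀ n adj a i {j l} → j ≢ l → extAdj n adj a (i , j) (i , l) ≡ true
extAdj-sameBlock n adj a i {j} {l} j≢l with i Fin.≟ i
... | yes _   = cong not (dec-false (toℕ j ℕ.≟ toℕ l) (j≢l ∘ toℕ-injective))
... | no  i≢i = contradiction refl i≢i

block-clique : ∀ n adj a i →
               AllPairs (λ u v → nonAdjacent (extAdj n adj a) u v ≡ false) (map (i ,_) (allFin (a i)))
block-clique n adj a i = map⁺ (tabulate⁺ sameBlock-nonAdjacent)
  where
  sameBlock-nonAdjacent : ∀ {j l} → j ≢ l → nonAdjacent (extAdj n adj a) (i , j) (i , l) ≡ false
  sameBlock-nonAdjacent {j} {l} j≢l =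
    cong (λ b → not b ∧ not (extAdj n adj a (i , l) (i , j))) (extAdj-sameBlock n adj a i j≢l)

extSum-afterFirstClique : ∀ n adj (a : Fin (suc n) → ℕ) ok g (j : Fin (a zero)) →
  let E = extAdj (suc n) adj a in
  indepSum E (λ u → rootOk ok u ∧ nonAdjacent E (zero , j) u) g (map shiftBlock (extEnum n (a ∘ suc)))
  ≡ extSum n (deleteVertex₀ adj) (a ∘ suc) (if isZeroF j then outsideNeighbourhood₀ adj ok else ok ∘ suc) g
extSum-afterFirstClique n adj a ok g j =
  indepSum-map (extAdj (suc n) adj a) (extAdj n (deleteVertex₀ adj) (a ∘ suc))
               shiftBlock (extAdj-shiftBlock n adj a) allowed-shiftBlock g (extEnum n (a ∘ suc))
  where
  allowed-shiftBlock : ∀ (w : ExtV n (a ∘ suc)) →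
    (rootOk ok (shiftBlock {a = a} w) ∧ nonAdjacent (extAdj (suc n) adj a) (zero , j) (shiftBlock w))
    ≡ rootOk (if isZeroF j then outsideNeighbourhood₀ adj ok else ok ∘ suc) w
  allowed-shiftBlock (i , l) with isZeroF j | isZeroF l
  ... | true  | true  = refl
  ... | true  | false = refl
  ... | false | true  = ∧-identityʳ (ok (suc i))
  ... | false | false = refl

extSum-suc : ∀ n adj (a : Fin (suc n) → ℕ) .{{_ : ℕ.NonZero (a zero)}} ok g →
  extSum (suc n) adj a ok g ≡
  extSum n (deleteVertex₀ adj) (a ∘ suc) (ok ∘ suc) g
  + (𝟙[ ok zero ] * extSum n (deleteVertex₀ adj) (a ∘ suc) (outsideNeighbourhood₀ adj ok) (g ∘ suc)
     + (ℕtoℚ (a zero) - 1ℚ) * extSum n (deleteVertex₀ adj) (a ∘ suc) (ok ∘ suc) (g ∘ suc))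
extSum-suc n adj a ok g = begin
  indepSum E (rootOk ok) g (extEnum (suc n) a)
    ≡⟨ cong (indepSum E (rootOk ok) g) (extEnum-suc n a) ⟩
  indepSum E (rootOk ok) g (firstClique ++ map shiftBlock rest)
    ≡⟨ indepSum-++-clique E (rootOk ok) g firstClique _ (block-clique (suc n) adj a zero) ⟩
  indepSum E (rootOk ok) g (map shiftBlock rest) + sumℚ (map pick firstClique)
    ≡⟨ cong₂ _+_ (indepSum-map E E′ shiftBlock (extAdj-shiftBlock n adj a) (λ _ → refl) g rest)
                 firstClique-sum ⟩
  extSum n adj′ (a ∘ suc) (ok ∘ suc) g + (pickBy true + (ℕtoℚ (a zero) - 1ℚ) * afterNonRoot)
    ∎
  where
  E = extAdj (suc n) adj a
  adj′ = deleteVertex₀ adj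
  E′ = extAdj n adj′ (a ∘ suc)
  firstClique = map (zero ,_) (allFin (a zero))
  rest = extEnum n (a ∘ suc)
  pick : ExtV (suc n) a → ℚ
  pick v = 𝟙[ rootOk ok v ]
           * indepSum E (λ u → rootOk ok u ∧ nonAdjacent E v u) (g ∘ suc) (map shiftBlock rest)
  pickBy : Bool → ℚ
  pickBy b = 𝟙[ if b then ok zero else true ]
             * extSum n adj′ (a ∘ suc) (if b then outsideNeighbourhood₀ adj ok else ok ∘ suc) (g ∘ suc)
  afterNonRoot = extSum n adj′ (a ∘ suc) (ok ∘ suc) (g ∘ suc)
  firstClique-sum : sumℚ (map pick firstClique) ≡ pickBy true + (ℕtoℚ (a zero) - 1ℚ) * afterNonRoot
  firstClique-sum = begin
    sumℚ (map pick firstClique)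
      ≡⟨ cong sumℚ (map-∘ (allFin (a zero))) ⟨
    sumℚ (map (pick ∘ (zero ,_)) (allFin (a zero)))
      ≡⟨ cong sumℚ (map-cong (λ j → cong (𝟙[ if isZeroF j then ok zero else true ] *_)
                                         (extSum-afterFirstClique n adj a ok (g ∘ suc) j))
                             (allFin (a zero))) ⟩
    sumℚ (map (λ j → pickBy (isZeroF j)) (allFin (a zero)))
      ≡⟨ sumℚ-allFin-isZeroF (a zero) pickBy ⟩
    pickBy true + (ℕtoℚ (a zero) - 1ℚ) * (1ℚ * afterNonRoot)
      ≡⟨ cong (λ q → pickBy true + (ℕtoℚ (a zero) - 1ℚ) * q) (*-identityˡ afterNonRoot) ⟩
    pickBy true + (ℕtoℚ (a zero) - 1ℚ) * afterNonRoot
      ∎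

δ : ℕ → ℕ → ℚ
δ m k = 𝟙[ k ℕ.≡ᵇ m ]

extSum-δ-beyond : ∀ n adj (a : Fin n → ℕ) → (∀ i → ℕ.NonZero (a i)) →
                  ∀ ok {m} → n ℕ.< m → extSum n adj a ok (δ m) ≡ 0ℚ
extSum-δ-beyond zero    adj a a≢0 ok {suc m} _ =
  indepSum-[] (extAdj zero adj a) (rootOk ok) (δ (suc m))
extSum-δ-beyond (suc n) adj a a≢0 ok {suc m} (s≤s n<m) =
  trans (extSum-suc n adj a {{a≢0 zero}} ok (δ (suc m)))
        (vanishes 𝟙[ ok zero ] (ℕtoℚ (a zero) - 1ℚ)
                  (extSum-δ-beyond n adj′ (a ∘ suc) (a≢0 ∘ suc) (ok ∘ suc) (ℕ.m<n⇒m<1+n n<m))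
                  (extSum-δ-beyond n adj′ (a ∘ suc) (a≢0 ∘ suc) (outsideNeighbourhood₀ adj ok) n<m)
                  (extSum-δ-beyond n adj′ (a ∘ suc) (a≢0 ∘ suc) (ok ∘ suc) n<m))
  where
  adj′ = deleteVertex₀ adj
  annihilate : ∀ b c → 0ℚ + (b * 0ℚ + c * 0ℚ) ≡ 0ℚ
  annihilate = solve-∀ ℚ-ring
  vanishes : ∀ b c {p q r} → p ≡ 0ℚ → q ≡ 0ℚ → r ≡ 0ℚ → p + (b * q + c * r) ≡ 0ℚ
  vanishes b c refl refl refl = annihilate b c

extSum-δ-exact : ∀ n adj (a : Fin n → ℕ) → (∀ i → ℕ.NonZero (a i)) →
                 ∀ ok → extSum n adj a ok (δ n) ≡ cliqueExtensionPoly n adj ok (λ i → ℕtoℚ (a i))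
extSum-δ-exact zero    adj a a≢0 ok = indepSum-[] (extAdj zero adj a) (rootOk ok) (δ zero)
extSum-δ-exact (suc n) adj a a≢0 ok = begin
  extSum (suc n) adj a ok (δ (suc n))
    ≡⟨ extSum-suc n adj a {{a≢0 zero}} ok (δ (suc n)) ⟩
  extSum n adj′ a′ (ok ∘ suc) (δ (suc n))
  + (𝟙[ ok zero ] * extSum n adj′ a′ (outsideNeighbourhood₀ adj ok) (δ n)
     + (ℕtoℚ (a zero) - 1ℚ) * extSum n adj′ a′ (ok ∘ suc) (δ n))
    ≡⟨ cong₂ _+_ (extSum-δ-beyond n adj′ a′ (a≢0 ∘ suc) (ok ∘ suc) (ℕ.n<1+n n))
                 (cong₂ (λ p q → 𝟙[ ok zero ] * p + (ℕtoℚ (a zero) - 1ℚ) * q)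
                        (extSum-δ-exact n adj′ a′ (a≢0 ∘ suc) _)
                        (extSum-δ-exact n adj′ a′ (a≢0 ∘ suc) _)) ⟩
  0ℚ + cliqueExtensionPoly (suc n) adj ok (λ i → ℕtoℚ (a i))
    ≡⟨ +-identityˡ _ ⟩
  cliqueExtensionPoly (suc n) adj ok (λ i → ℕtoℚ (a i))
    ∎
  where
  adj′ = deleteVertex₀ adj
  a′ = a ∘ suc

numIndepExt≡cliqueExtensionPoly : ∀ n adj (a : Fin n → ℕ) → (∀ i → ℕ.NonZero (a i)) →
  ℕtoℚ (numIndepExt n adj a n) ≡ cliqueExtensionPoly n adj (λ _ → true) (λ i → ℕtoℚ (a i))
numIndepExt≡cliqueExtensionPoly n adj a a≢0 = begin
  ℕtoℚ (numIndepExt n adj a n)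
    ≡⟨ ℕtoℚ-length-filterᵇ (λ I → length I ℕ.≡ᵇ n) (independentSets E (extEnum n a)) ⟩
  sumℚ (map (λ I → δ n (length I)) (independentSets E (extEnum n a)))
    ≡⟨ indepSum-unrestricted E (λ { (i , j) → if-eta (isZeroF j) }) (δ n) (extEnum n a) ⟨
  extSum n adj a (λ _ → true) (δ n)
    ≡⟨ extSum-δ-exact n adj a a≢0 (λ _ → true) ⟩
  cliqueExtensionPoly n adj (λ _ → true) (λ i → ℕtoℚ (a i))
    ∎
  where E = extAdj n adj a

data MultiAffine : (n : ℕ) → ((Fin n → ℚ) → ℚ) → Set where
  constant : ∀ {F} c → (∀ a → F a ≡ c) → MultiAffine zero F
  affine   : ∀ {n F} F₀ F₁ → MultiAffine n F₀ → MultiAffine n F₁ →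
             (∀ a → F a ≡ F₀ (a ∘ suc) + a zero * F₁ (a ∘ suc)) → MultiAffine (suc n) F

multiAffine-linear : ∀ {n F G} c d → MultiAffine n F → MultiAffine n G →
                     MultiAffine n (λ a → c * F a + d * G a)
multiAffine-linear c d (constant p F≡p) (constant q G≡q) =
  constant (c * p + d * q) (λ a → cong₂ (λ u v → c * u + d * v) (F≡p a) (G≡q a))
multiAffine-linear c d (affine F₀ F₁ mF₀ mF₁ F≡) (affine G₀ G₁ mG₀ mG₁ G≡) =
  affine (λ a → c * F₀ a + d * G₀ a) (λ a → c * F₁ a + d * G₁ a)
         (multiAffine-linear c d mF₀ mG₀) (multiAffine-linear c d mF₁ mG₁)
         (λ a → trans (cong₂ (λ u v → c * u + d * v) (F≡ a) (G≡ a)) (regroup c d _ _ (a zero) _ _))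
  where
  regroup : ∀ c d p q t r s →
            c * (p + t * q) + d * (r + t * s) ≡ (c * p + d * r) + t * (c * q + d * s)
  regroup = solve-∀ ℚ-ring

evalML-suc : ∀ {n} (f : MultiLin (suc n)) a →
             evalML f a ≡
             evalML (λ S → f (false ∷ S)) (a ∘ suc) + a zero * evalML (λ S → f (true ∷ S)) (a ∘ suc)
evalML-suc {n} f a = begin
  sumℚ (map term (map (false ∷_) S ++ map (true ∷_) S))
    ≡⟨ cong sumℚ (map-++ term (map (false ∷_) S) (map (true ∷_) S)) ⟩
  sumℚ (map term (map (false ∷_) S) ++ map term (map (true ∷_) S))
    ≡⟨ sumℚ-++ (map term (map (false ∷_) S)) _ ⟩
  sumℚ (map term (map (false ∷_) S)) + sumℚ (map term (map (true ∷_) S))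
    ≡⟨ cong₂ _+_ (trans (cong sumℚ (sym (map-∘ S))) (cong sumℚ (map-cong term-false S)))
                 (trans (cong sumℚ (sym (map-∘ S)))
                        (trans (cong sumℚ (map-cong term-true S)) (sumℚ-*ˡ (a zero) _ S))) ⟩
  evalML (λ S → f (false ∷ S)) (a ∘ suc) + a zero * evalML (λ S → f (true ∷ S)) (a ∘ suc)
    ∎
  where
  S = allSubsets n
  term : Vec Bool (suc n) → ℚ
  term T = f T * monomial T a
  term-false : ∀ T → term (false ∷ T) ≡ f (false ∷ T) * monomial T (a ∘ suc)
  term-false T = cong (f (false ∷ T) *_) (*-identityˡ _)
  term-true : ∀ T → term (true ∷ T) ≡ a zero * (f (true ∷ T) * monomial T (a ∘ suc))
  term-true T = swap (f (true ∷ T)) (a zero) _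
    where
    swap : ∀ p t q → p * (t * q) ≡ t * (p * q)
    swap = solve-∀ ℚ-ring

multiAffine-evalML : ∀ {n} (f : MultiLin n) → MultiAffine n (evalML f)
multiAffine-evalML {zero}  f = constant (f [] * 1ℚ + 0ℚ) (λ _ → refl)
multiAffine-evalML {suc n} f =
  affine _ _ (multiAffine-evalML (λ S → f (false ∷ S))) (multiAffine-evalML (λ S → f (true ∷ S)))
         (evalML-suc f)

multiAffine-cliqueExtensionPoly : ∀ n adj ok → MultiAffine n (cliqueExtensionPoly n adj ok)
multiAffine-cliqueExtensionPoly zero    adj ok = constant 1ℚ (λ _ → refl)
multiAffine-cliqueExtensionPoly (suc n) adj ok =
  affine _ _
    (multiAffine-linear 𝟙[ ok zero ] (- 1ℚ)
                        (multiAffine-cliqueExtensionPoly n _ _) (multiAffine-cliqueExtensionPoly n _ _))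
    (multiAffine-cliqueExtensionPoly n _ _)
    (λ a → regroup 𝟙[ ok zero ] _ (a zero) _)
  where
  regroup : ∀ b p t q → b * p + (t - 1ℚ) * q ≡ (b * p + (- 1ℚ) * q) + t * q
  regroup = solve-∀ ℚ-ring

affine-unique : ∀ t p q r s → p + t * q ≡ r + t * s → p + (t + 1ℚ) * q ≡ r + (t + 1ℚ) * s →
                p ≡ r × q ≡ s
affine-unique t p q r s at-t at-t+1 = p≡r , q≡s
  where
  difference : ∀ t p q → q ≡ (p + (t + 1ℚ) * q) - (p + t * q)
  difference = solve-∀ ℚ-ring
  intercept : ∀ t p q → p ≡ (p + t * q) - t * q
  intercept = solve-∀ ℚ-ring
  q≡s : q ≡ s
  q≡s = trans (difference t p q) (trans (cong₂ _-_ at-t+1 at-t) (sym (difference t r s)))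
  p≡r : p ≡ r
  p≡r = trans (intercept t p q) (trans (cong₂ (λ u v → u - t * v) at-t q≡s) (sym (intercept t r s)))

OnGrid : ∀ {n} → (Fin n → ℕ) → Set
OnGrid b = ∀ i → b i ≡ 2 ⊎ b i ≡ 3

multiAffine-unique : ∀ {n F G} → MultiAffine n F → MultiAffine n G →
                     (∀ b → OnGrid b → F (ℕtoℚ ∘ b) ≡ G (ℕtoℚ ∘ b)) → ∀ a → F a ≡ G a
multiAffine-unique (constant p F≡p) (constant q G≡q) agree a =
  trans (F≡p a) (trans (sym (F≡p _)) (trans (agree (λ ()) (λ ())) (trans (G≡q _) (sym (G≡q a)))))
multiAffine-unique {F = F} {G} (affine F₀ F₁ mF₀ mF₁ F≡) (affine G₀ G₁ mG₀ mG₁ G≡) agree a = begin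
  F a                     ≡⟨ F≡ a ⟩
  F₀ a′ + a zero * F₁ a′  ≡⟨ cong₂ (λ u v → u + a zero * v)
                                   (multiAffine-unique mF₀ mG₀ (λ r r∈ → proj₁ (slices r r∈)) a′)
                                   (multiAffine-unique mF₁ mG₁ (λ r r∈ → proj₂ (slices r r∈)) a′) ⟩
  G₀ a′ + a zero * G₁ a′  ≡⟨ G≡ a ⟨
  G a                     ∎
  where
  a′ = a ∘ suc
  at : ∀ t r → OnGrid r → t ≡ 2 ⊎ t ≡ 3 →
       F₀ (ℕtoℚ ∘ r) + ℕtoℚ t * F₁ (ℕtoℚ ∘ r) ≡ G₀ (ℕtoℚ ∘ r) + ℕtoℚ t * G₁ (ℕtoℚ ∘ r)
  at t r r∈ t∈ = trans (sym (F≡ _)) (trans (agree (t Vector.∷ r) grid) (G≡ _))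
    where
    grid : OnGrid (t Vector.∷ r)
    grid zero    = t∈
    grid (suc i) = r∈ i
  slices : ∀ r → OnGrid r → F₀ (ℕtoℚ ∘ r) ≡ G₀ (ℕtoℚ ∘ r) × F₁ (ℕtoℚ ∘ r) ≡ G₁ (ℕtoℚ ∘ r)
  slices r r∈ = affine-unique (ℕtoℚ 2) _ _ _ _ (at 2 r r∈ (inj₁ refl)) (at 3 r r∈ (inj₂ refl))

associatedPoly≡cliqueExtensionPoly : ∀ n adj (f : MultiLin n) → IsAssociatedPoly n adj f →
                                     ∀ a → evalML f a ≡ cliqueExtensionPoly n adj (λ _ → true) a
associatedPoly≡cliqueExtensionPoly n adj f f-counts =
  multiAffine-unique (multiAffine-evalML f) (multiAffine-cliqueExtensionPoly n adj _) agree
  where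
  2≤ : ∀ {t} → t ≡ 2 ⊎ t ≡ 3 → 2 ℕ.≤ t
  2≤ (inj₁ refl) = s≤s (s≤s z≤n)
  2≤ (inj₂ refl) = s≤s (s≤s z≤n)
  agree : ∀ b → OnGrid b → evalML f (ℕtoℚ ∘ b) ≡ cliqueExtensionPoly n adj (λ _ → true) (ℕtoℚ ∘ b)
  agree b b∈ = trans (f-counts b (2≤ ∘ b∈))
                     (numIndepExt≡cliqueExtensionPoly n adj b
                       (λ i → ℕ.>-nonZero (ℕ.≤-trans (s≤s z≤n) (2≤ (b∈ i)))))

-- isIndependent tests both orientations of every pair of distinct vertices.
theorem5p3 : (n : ℕ) (adj : Fin n → Fin n → Bool) →
    (∀ i j → adj i j ≡ adj j i) → (∀ i → adj i i ≡ false) →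
    (f : MultiLin n) → IsAssociatedPoly n adj f →
    (x : ℚ) → .{{_ : NonZero x}} →
    signedIndepPoly n adj x ≡ powℚ (- x) n * evalML f (λ _ → 1ℚ - 1/ x)
theorem5p3 n adj _ _ f f-counts x = begin
  signedIndepPoly n adj x
    ≡⟨ indepSum-unrestricted adj (λ _ → refl) (powℚ (- x)) (allFin n) ⟨
  indepSum adj (λ _ → true) (powℚ (- x)) (allFin n)
    ≡⟨ indepSum-signed≡cliqueExtensionPoly x n adj (λ _ → true) ⟩
  powℚ (- x) n * cliqueExtensionPoly n adj (λ _ → true) (λ _ → 1ℚ - 1/ x)
    ≡⟨ cong (powℚ (- x) n *_) (associatedPoly≡cliqueExtensionPoly n adj f f-counts _) ⟨
  powℚ (- x) n * evalML f (λ _ → 1ℚ - 1/ x)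
    ∎
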